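{- Let $R$ be a commutative ring, $L$ a Lie algebra over $R$, $M$ a Lie module over $L$, $I \subseteq L$ a Lie ideal, and $x \in L$ such that $R x + I = L$ (as $R$-submodules). Let $n, i, j$ be natural numbers such that $\phi_x^n = 0$, where $\phi_x : M \to M$, $m \mapsto [x,m]$, and such that $C_i M \subseteq I^{(j)} M$. Then $C_{i+n} M \subseteq I^{(j+1)} M$.
   Context: A Lie algebra over a commutative ring $R$ is an $R$-module with an $R$-bilinear bracket satisfying $[x,x]=0$ and the Jacobi identity; a Lie module $M$ over $L$ is an $R$-module with bilinear action $[x,m]$ satisfying $[x,[y,m]] = [[x,y],m] + [y,[x,m]]$. For a Lie ideal $J \subseteq L$ and Lie submodule $N \subseteq M$, $[J,N]$ is the smallest Lie submodule of $M$ containing all $[y,m]$ with $y \in J$, $m \in N$. The lower central series of $M$ is $C_0 M = M$, $C_{k+1} M = [L, C_k M]$. For the ideal $I$, define $I^{(0)} M = M$ and $I^{(k+1)} M = [I, I^{(k)} M]$. -}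

module Defs where

open import Level using (Level; _⊔_; Lift; lift) renaming (suc to lsuc)
open import Data.Nat using (ℕ; zero; suc)
open import Data.Unit using (⊤)
open import Data.Product using (Σ; ∃; _×_; _,_)
open import Relation.Unary using (Pred; _⊆_; _∈_)
open import Algebra.Bundles using (CommutativeRing)
open import Algebra.Module.Bundles using (Module)

private
  variable
    r ℓr l ℓl m ℓm : Level

record LieAlgebra (R : CommutativeRing r ℓr) l ℓl : Set (r ⊔ ℓr ⊔ lsuc (l ⊔ ℓl)) where
  open CommutativeRing R using () renaming (Carrier to Sc)
  field
    module′ : Module R l ℓl
  open Module module′ public
  field
    ⁅_,_⁆ : Carrierᴹ → Carrierᴹ → Carrierᴹ
    ⁅⁆-cong : ∀ {x x′ y y′} → x ≈ᴹ x′ → y ≈ᴹ y′ → ⁅ x , y ⁆ ≈ᴹ ⁅ x′ , y′ ⁆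
    add-left : ∀ x y z → ⁅ x +ᴹ y , z ⁆ ≈ᴹ ⁅ x , z ⁆ +ᴹ ⁅ y , z ⁆
    add-right : ∀ x y z → ⁅ x , y +ᴹ z ⁆ ≈ᴹ ⁅ x , y ⁆ +ᴹ ⁅ x , z ⁆
    smul-left : ∀ (t : Sc) x y → ⁅ t *ₗ x , y ⁆ ≈ᴹ t *ₗ ⁅ x , y ⁆
    smul-right : ∀ (t : Sc) x y → ⁅ x , t *ₗ y ⁆ ≈ᴹ t *ₗ ⁅ x , y ⁆
    alternate : ∀ x → ⁅ x , x ⁆ ≈ᴹ 0ᴹ
    jacobi : ∀ x y z → ⁅ x , ⁅ y , z ⁆ ⁆ +ᴹ ⁅ y , ⁅ z , x ⁆ ⁆ +ᴹ ⁅ z , ⁅ x , y ⁆ ⁆ ≈ᴹ 0ᴹ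

record LieModule {R : CommutativeRing r ℓr} (L : LieAlgebra R l ℓl) m ℓm
       : Set (r ⊔ ℓr ⊔ l ⊔ ℓl ⊔ lsuc (m ⊔ ℓm)) where
  open CommutativeRing R using () renaming (Carrier to Sc)
  open LieAlgebra L using () renaming (Carrierᴹ to Lc; _≈ᴹ_ to _≈ᴸ_; _+ᴹ_ to _+ᴸ_; _*ₗ_ to _*ᴸ_; ⁅_,_⁆ to ⁅_,_⁆ᴸ)
  field
    module′ : Module R m ℓm
  open Module module′ public
  field
    ⁅_,_⁆ : Lc → Carrierᴹ → Carrierᴹ
    ⁅⁆-cong : ∀ {x x′ u u′} → x ≈ᴸ x′ → u ≈ᴹ u′ → ⁅ x , u ⁆ ≈ᴹ ⁅ x′ , u′ ⁆
    add-left : ∀ x y u → ⁅ x +ᴸ y , u ⁆ ≈ᴹ ⁅ x , u ⁆ +ᴹ ⁅ y , u ⁆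
    add-right : ∀ x u v → ⁅ x , u +ᴹ v ⁆ ≈ᴹ ⁅ x , u ⁆ +ᴹ ⁅ x , v ⁆
    smul-left : ∀ (t : Sc) x u → ⁅ t *ᴸ x , u ⁆ ≈ᴹ t *ₗ ⁅ x , u ⁆
    smul-right : ∀ (t : Sc) x u → ⁅ x , t *ₗ u ⁆ ≈ᴹ t *ₗ ⁅ x , u ⁆
    leibniz : ∀ x y u → ⁅ x , ⁅ y , u ⁆ ⁆ ≈ᴹ ⁅ ⁅ x , y ⁆ᴸ , u ⁆ +ᴹ ⁅ y , ⁅ x , u ⁆ ⁆

module LieTheory {R : CommutativeRing r ℓr} (L : LieAlgebra R l ℓl) (M : LieModule L m ℓm) where
  open CommutativeRing R using () renaming (Carrier to Sc)
  open LieAlgebra L using () renaming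
    (Carrierᴹ to Lc; _≈ᴹ_ to _≈ᴸ_; _+ᴹ_ to _+ᴸ_; _*ₗ_ to _*ᴸ_; 0ᴹ to 0ᴸ; ⁅_,_⁆ to ⁅_,_⁆ᴸ)
  open LieModule M

  record IsLieIdeal {i} (I : Pred Lc i) : Set (r ⊔ l ⊔ ℓl ⊔ i) where
    field
      resp : ∀ {x y} → x ≈ᴸ y → x ∈ I → y ∈ I
      zero∈ : 0ᴸ ∈ I
      +∈ : ∀ {x y} → x ∈ I → y ∈ I → (x +ᴸ y) ∈ I
      *∈ : ∀ (t : Sc) {x} → x ∈ I → (t *ᴸ x) ∈ I
      ⁅⁆∈ : ∀ (z : Lc) {y} → y ∈ I → ⁅ z , y ⁆ᴸ ∈ I

  -- [J, N]: the smallest Lie submodule of M containing all [y, u] with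
  -- y ∈ J, u ∈ N (inductively generated closure).
  data Br {j n} (J : Pred Lc j) (N : Pred Carrierᴹ n)
       : Pred Carrierᴹ (r ⊔ l ⊔ m ⊔ ℓm ⊔ j ⊔ n) where
    gen  : ∀ {y u} → y ∈ J → u ∈ N → Br J N ⁅ y , u ⁆
    resp : ∀ {u v} → u ≈ᴹ v → Br J N u → Br J N v
    zero : Br J N 0ᴹ
    add  : ∀ {u v} → Br J N u → Br J N v → Br J N (u +ᴹ v)
    smul : ∀ (t : Sc) {u} → Br J N u → Br J N (t *ₗ u)
    act  : ∀ (z : Lc) {u} → Br J N u → Br J N ⁅ z , u ⁆

  Lall : Pred Lc Level.zero
  Lall _ = ⊤

  C : ℕ → Pred Carrierᴹ (r ⊔ l ⊔ m ⊔ ℓm)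
  C zero _ = Lift (r ⊔ l ⊔ m ⊔ ℓm) ⊤
  C (suc k) = Br Lall (C k)

  Ipow : ∀ {i} → Pred Lc i → ℕ → Pred Carrierᴹ (r ⊔ l ⊔ m ⊔ ℓm ⊔ i)
  Ipow {i} I zero _ = Lift (r ⊔ l ⊔ m ⊔ ℓm ⊔ i) ⊤
  Ipow I (suc k) = Br I (Ipow I k)

  φ : Lc → Carrierᴹ → Carrierᴹ
  φ x u = ⁅ x , u ⁆

  φ^ : Lc → ℕ → Carrierᴹ → Carrierᴹ
  φ^ x zero u = u
  φ^ x (suc n) u = φ x (φ^ x n u)

{-# OPTIONS --safe #-}
-- Every element of C_{k+s} M has the form φ_x^s(w) + v with w ∈ C_k M and
-- v ∈ I^(j+1) M.  For s + 1, bracket such an element with z = t x + y (y ∈ I):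
-- the part [z, v] stays in I^(j+1) M, while [z, φ_x^s w] = φ_x^(s+1)(t w) + [y, φ_x^s w],
-- and [y, φ_x^s w] ∈ [I, C_k M] ⊆ I^(j+1) M.  Taking s = n kills φ_x^n w.
module Submission where

open import Defs
open import Level using (Level; _⊔_; lift)
open import Data.Nat using (ℕ; _+_; suc; zero)
open import Data.Nat.Properties using (+-suc; +-identityʳ)
open import Data.Product using (Σ; ∃; _×_; _,_)
open import Relation.Unary using (Pred; _⊆_; _∈_)
open import Algebra.Bundles using (CommutativeRing; CommutativeMonoid)
open import Relation.Binary.PropositionalEquality as ≡ using (_≡_)
import Relation.Binary.Reasoning.Setoid as SetoidReasoning
import Algebra.Properties.CommutativeSemigroup as CommutativeSemigroupProperties

module LieSubmodules {r ℓr l ℓl m ℓm : Level}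
    {R : CommutativeRing r ℓr} (L : LieAlgebra R l ℓl) (M : LieModule L m ℓm) where

  open CommutativeRing R using () renaming (Carrier to Sc; 0# to 0#)
  open LieAlgebra L using () renaming
    (Carrierᴹ to Lc; _≈ᴹ_ to _≈ᴸ_; _+ᴹ_ to _+ᴸ_; _*ₗ_ to _*ᴸ_; ≈ᴹ-refl to ≈ᴸ-refl)
  open LieModule M
  open LieTheory L M
  open SetoidReasoning ≈ᴹ-setoid

  record IsLieSubmodule {p} (P : Pred Carrierᴹ p) : Set (r ⊔ l ⊔ m ⊔ ℓm ⊔ p) where
    field
      ∈-resp-≈ : ∀ {u v} → u ≈ᴹ v → u ∈ P → v ∈ P
      zero∈ : 0ᴹ ∈ P
      +∈ : ∀ {u v} → u ∈ P → v ∈ P → (u +ᴹ v) ∈ P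
      *∈ : ∀ (t : Sc) {u} → u ∈ P → (t *ₗ u) ∈ P
      ⁅⁆∈ : ∀ (z : Lc) {u} → u ∈ P → ⁅ z , u ⁆ ∈ P

  Br-isLieSubmodule : ∀ {j n} {J : Pred Lc j} {N : Pred Carrierᴹ n} →
                      IsLieSubmodule (Br J N)
  Br-isLieSubmodule = record
    { ∈-resp-≈ = resp ; zero∈ = zero ; +∈ = add ; *∈ = smul ; ⁅⁆∈ = act }

  Br-least : ∀ {j n p} {J : Pred Lc j} {N : Pred Carrierᴹ n} {P : Pred Carrierᴹ p} →
             IsLieSubmodule P → (∀ {y u} → y ∈ J → u ∈ N → ⁅ y , u ⁆ ∈ P) →
             Br J N ⊆ P
  Br-least P-sub gen⊆P (gen y∈J u∈N) = gen⊆P y∈J u∈N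
  Br-least P-sub gen⊆P (resp e u∈) = IsLieSubmodule.∈-resp-≈ P-sub e (Br-least P-sub gen⊆P u∈)
  Br-least P-sub gen⊆P zero = IsLieSubmodule.zero∈ P-sub
  Br-least P-sub gen⊆P (add u∈ v∈) =
    IsLieSubmodule.+∈ P-sub (Br-least P-sub gen⊆P u∈) (Br-least P-sub gen⊆P v∈)
  Br-least P-sub gen⊆P (smul t u∈) = IsLieSubmodule.*∈ P-sub t (Br-least P-sub gen⊆P u∈)
  Br-least P-sub gen⊆P (act z u∈) = IsLieSubmodule.⁅⁆∈ P-sub z (Br-least P-sub gen⊆P u∈)

  C-isLieSubmodule : ∀ k → IsLieSubmodule (C k)
  C-isLieSubmodule zero = record
    { ∈-resp-≈ = λ _ _ → lift _ ; zero∈ = lift _ ; +∈ = λ _ _ → lift _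
    ; *∈ = λ _ _ → lift _ ; ⁅⁆∈ = λ _ _ → lift _ }
  C-isLieSubmodule (suc k) = Br-isLieSubmodule

  module _ (x : Lc) where

    φ^-∈ : ∀ {p} {P : Pred Carrierᴹ p} → IsLieSubmodule P →
           ∀ s {u} → u ∈ P → φ^ x s u ∈ P
    φ^-∈ P-sub zero u∈ = u∈
    φ^-∈ P-sub (suc s) u∈ = IsLieSubmodule.⁅⁆∈ P-sub x (φ^-∈ P-sub s u∈)

    φ^-cong : ∀ s {u v} → u ≈ᴹ v → φ^ x s u ≈ᴹ φ^ x s v
    φ^-cong zero e = e
    φ^-cong (suc s) e = ⁅⁆-cong ≈ᴸ-refl (φ^-cong s e)

    φ^-+ : ∀ s u v → φ^ x s (u +ᴹ v) ≈ᴹ φ^ x s u +ᴹ φ^ x s v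
    φ^-+ zero u v = ≈ᴹ-refl
    φ^-+ (suc s) u v = ≈ᴹ-trans (⁅⁆-cong ≈ᴸ-refl (φ^-+ s u v)) (add-right x _ _)

    φ^-*ₗ : ∀ s t u → φ^ x s (t *ₗ u) ≈ᴹ t *ₗ φ^ x s u
    φ^-*ₗ zero t u = ≈ᴹ-refl
    φ^-*ₗ (suc s) t u = ≈ᴹ-trans (⁅⁆-cong ≈ᴸ-refl (φ^-*ₗ s t u)) (smul-right t x _)

    φ^-0 : ∀ s → φ^ x s 0ᴹ ≈ᴹ 0ᴹ
    φ^-0 s = begin
      φ^ x s 0ᴹ         ≈⟨ φ^-cong s (≈ᴹ-sym (*ₗ-zeroˡ 0ᴹ)) ⟩
      φ^ x s (0# *ₗ 0ᴹ) ≈⟨ φ^-*ₗ s 0# 0ᴹ ⟩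
      0# *ₗ φ^ x s 0ᴹ   ≈⟨ *ₗ-zeroˡ _ ⟩
      0ᴹ                ∎

    φ^-suc′ : ∀ s u → φ^ x (suc s) u ≡ φ^ x s (φ x u)
    φ^-suc′ zero u = ≡.refl
    φ^-suc′ (suc s) u = ≡.cong (φ x) (φ^-suc′ s u)

    ⁅⁆-φ^-split : ∀ {z t y} → z ≈ᴸ t *ᴸ x +ᴸ y → ∀ s u →
                  ⁅ z , φ^ x s u ⁆ ≈ᴹ φ^ x (suc s) (t *ₗ u) +ᴹ ⁅ y , φ^ x s u ⁆
    ⁅⁆-φ^-split {z} {t} {y} z≈ s u = begin
      ⁅ z , φ^ x s u ⁆                          ≈⟨ ⁅⁆-cong z≈ ≈ᴹ-refl ⟩
      ⁅ t *ᴸ x +ᴸ y , φ^ x s u ⁆                ≈⟨ add-left _ _ _ ⟩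
      ⁅ t *ᴸ x , φ^ x s u ⁆ +ᴹ ⁅ y , φ^ x s u ⁆ ≈⟨ +ᴹ-congʳ (smul-left t x _) ⟩
      t *ₗ φ^ x (suc s) u +ᴹ ⁅ y , φ^ x s u ⁆   ≈⟨ +ᴹ-congʳ (≈ᴹ-sym (φ^-*ₗ (suc s) t u)) ⟩
      φ^ x (suc s) (t *ₗ u) +ᴹ ⁅ y , φ^ x s u ⁆ ∎

module LowerCentralSeries {r ℓr l ℓl m ℓm i : Level}
    {R : CommutativeRing r ℓr} (L : LieAlgebra R l ℓl) (M : LieModule L m ℓm)
    (I : Pred (LieAlgebra.Carrierᴹ L) i) (x : LieAlgebra.Carrierᴹ L)
    (L≈Rx+I : ∀ z → Σ (CommutativeRing.Carrier R) λ t → Σ (LieAlgebra.Carrierᴹ L) λ y →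
       y ∈ I × LieAlgebra._≈ᴹ_ L z (LieAlgebra._+ᴹ_ L (LieAlgebra._*ₗ_ L t x) y))
    (k j : ℕ) (Cₖ⊆Iʲ : LieTheory.C L M k ⊆ LieTheory.Ipow L M I j) where

  open LieModule M
  open LieTheory L M
  open LieSubmodules L M
  open CommutativeSemigroupProperties
    (CommutativeMonoid.commutativeSemigroup +ᴹ-commutativeMonoid) using (interchange)
  open SetoidReasoning ≈ᴹ-setoid

  Cₖ : IsLieSubmodule (C k)
  Cₖ = C-isLieSubmodule k

  φ^Cₖ+Iʲ⁺¹ : ℕ → Pred Carrierᴹ (r ⊔ l ⊔ m ⊔ ℓm ⊔ i)
  φ^Cₖ+Iʲ⁺¹ s u = ∃ λ w → C k w × ∃ λ v → Ipow I (suc j) v × (u ≈ᴹ φ^ x s w +ᴹ v)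

  ⁅⁆-φ^Cₖ+Iʲ⁺¹ : ∀ z s {u} → u ∈ φ^Cₖ+Iʲ⁺¹ s → ⁅ z , u ⁆ ∈ φ^Cₖ+Iʲ⁺¹ (suc s)
  ⁅⁆-φ^Cₖ+Iʲ⁺¹ z s {u} (w , w∈ , v , v∈ , u≈) with L≈Rx+I z
  ... | t , y , y∈I , z≈ =
    t *ₗ w , IsLieSubmodule.*∈ Cₖ t w∈ ,
    ⁅ y , φ^ x s w ⁆ +ᴹ ⁅ z , v ⁆ ,
    add (gen y∈I (Cₖ⊆Iʲ (φ^-∈ x Cₖ s w∈))) (act z v∈) ,
    (begin
      ⁅ z , u ⁆                                                 ≈⟨ ⁅⁆-cong (LieAlgebra.≈ᴹ-refl L) u≈ ⟩
      ⁅ z , φ^ x s w +ᴹ v ⁆                                     ≈⟨ add-right _ _ _ ⟩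
      ⁅ z , φ^ x s w ⁆ +ᴹ ⁅ z , v ⁆                             ≈⟨ +ᴹ-congʳ (⁅⁆-φ^-split x z≈ s w) ⟩
      (φ^ x (suc s) (t *ₗ w) +ᴹ ⁅ y , φ^ x s w ⁆) +ᴹ ⁅ z , v ⁆ ≈⟨ +ᴹ-assoc _ _ _ ⟩
      φ^ x (suc s) (t *ₗ w) +ᴹ (⁅ y , φ^ x s w ⁆ +ᴹ ⁅ z , v ⁆) ∎)

  φ^Cₖ+Iʲ⁺¹-suc⊆ : ∀ s → φ^Cₖ+Iʲ⁺¹ (suc s) ⊆ φ^Cₖ+Iʲ⁺¹ s
  φ^Cₖ+Iʲ⁺¹-suc⊆ s (w , w∈ , v , v∈ , u≈) =
    φ x w , IsLieSubmodule.⁅⁆∈ Cₖ x w∈ , v , v∈ ,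
    ≈ᴹ-trans u≈ (+ᴹ-congʳ (≈ᴹ-reflexive (φ^-suc′ x s w)))

  φ^Cₖ+Iʲ⁺¹-isLieSubmodule : ∀ s → IsLieSubmodule (φ^Cₖ+Iʲ⁺¹ (suc s))
  φ^Cₖ+Iʲ⁺¹-isLieSubmodule s = record
    { ∈-resp-≈ = λ { e (w , w∈ , v , v∈ , u≈) → w , w∈ , v , v∈ , ≈ᴹ-trans (≈ᴹ-sym e) u≈ }
    ; zero∈ = 0ᴹ , IsLieSubmodule.zero∈ Cₖ , 0ᴹ , zero ,
        ≈ᴹ-sym (≈ᴹ-trans (+ᴹ-congʳ (φ^-0 x (suc s))) (+ᴹ-identityˡ 0ᴹ))
    ; +∈ = λ { (w₁ , w₁∈ , v₁ , v₁∈ , u₁≈) (w₂ , w₂∈ , v₂ , v₂∈ , u₂≈) →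
        w₁ +ᴹ w₂ , IsLieSubmodule.+∈ Cₖ w₁∈ w₂∈ , v₁ +ᴹ v₂ , add v₁∈ v₂∈ ,
        ≈ᴹ-trans (+ᴹ-cong u₁≈ u₂≈) (≈ᴹ-trans (interchange _ _ _ _)
          (+ᴹ-congʳ (≈ᴹ-sym (φ^-+ x (suc s) w₁ w₂)))) }
    ; *∈ = λ { t (w , w∈ , v , v∈ , u≈) →
        t *ₗ w , IsLieSubmodule.*∈ Cₖ t w∈ , t *ₗ v , smul t v∈ ,
        ≈ᴹ-trans (*ₗ-congˡ u≈) (≈ᴹ-trans (*ₗ-distribˡ t _ _)
          (+ᴹ-congʳ (≈ᴹ-sym (φ^-*ₗ x (suc s) t w)))) }
    ; ⁅⁆∈ = λ z u∈ → ⁅⁆-φ^Cₖ+Iʲ⁺¹ z s (φ^Cₖ+Iʲ⁺¹-suc⊆ s u∈)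
    }

  C-shift⊆φ^Cₖ+Iʲ⁺¹ : ∀ s → C (k + s) ⊆ φ^Cₖ+Iʲ⁺¹ s
  C-shift⊆φ^Cₖ+Iʲ⁺¹ zero {u} u∈ =
    u , ≡.subst (λ q → C q u) (+-identityʳ k) u∈ , 0ᴹ , zero , ≈ᴹ-sym (+ᴹ-identityʳ u)
  C-shift⊆φ^Cₖ+Iʲ⁺¹ (suc s) {u} u∈ =
    Br-least (φ^Cₖ+Iʲ⁺¹-isLieSubmodule s)
      (λ {z} _ v∈ → ⁅⁆-φ^Cₖ+Iʲ⁺¹ z s (C-shift⊆φ^Cₖ+Iʲ⁺¹ s v∈))
      (≡.subst (λ q → C q u) (+-suc k s) u∈)

  C-shift⊆Iʲ⁺¹ : ∀ n → (∀ u → φ^ x n u ≈ᴹ 0ᴹ) → C (k + n) ⊆ Ipow I (suc j)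
  C-shift⊆Iʲ⁺¹ n φⁿ≈0 u∈ with C-shift⊆φ^Cₖ+Iʲ⁺¹ n u∈
  ... | w , _ , v , v∈ , u≈ =
    resp (≈ᴹ-sym (≈ᴹ-trans u≈ (≈ᴹ-trans (+ᴹ-congʳ (φⁿ≈0 w)) (+ᴹ-identityˡ v)))) v∈

-- The argument never uses that I is an ideal: [I, -] is a generated closure anyway.
mainTheorem4 : ∀ {r ℓr l ℓl m ℓm i : Level}
    (R : CommutativeRing r ℓr) (L : LieAlgebra R l ℓl) (M : LieModule L m ℓm)
    (I : Pred (LieAlgebra.Carrierᴹ L) i) → LieTheory.IsLieIdeal L M I →
    (x : LieAlgebra.Carrierᴹ L) →
    (∀ z → Σ (CommutativeRing.Carrier R) λ t → Σ (LieAlgebra.Carrierᴹ L) λ y →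
       y ∈ I × LieAlgebra._≈ᴹ_ L z (LieAlgebra._+ᴹ_ L (LieAlgebra._*ₗ_ L t x) y)) →
    (n k j : ℕ) →
    (∀ u → LieModule._≈ᴹ_ M (LieTheory.φ^ L M x n u) (LieModule.0ᴹ M)) →
    LieTheory.C L M k ⊆ LieTheory.Ipow L M I j →
    LieTheory.C L M (k + n) ⊆ LieTheory.Ipow L M I (suc j)
mainTheorem4 R L M I _ x L≈Rx+I n k j φⁿ≈0 Cₖ⊆Iʲ =
  LowerCentralSeries.C-shift⊆Iʲ⁺¹ L M I x L≈Rx+I k j Cₖ⊆Iʲ n φⁿ≈0
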